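{- Let $G \simeq C_{n_1} \oplus \dots \oplus C_{n_r}$ with integers $1 < n_1 \mid n_2 \mid \dots \mid n_r$, and assume that either (i) $G$ is cyclic (i.e. $r=1$), or (ii) $G$ is a $p$-group for some prime $p$. Then every zero-sumfree sequence $S$ in $G$ with $|S| \geq \sum_{i=1}^r (n_i-1)$ satisfies $$\mathsf{k}(S) \leq \sum_{i=1}^r \frac{n_i-1}{n_i}.$$
   Context: $C_k$ denotes the cyclic group of order $k$. A sequence in a finite abelian group $G$ (written additively) is a finite list $S=(g_1,\dots,g_\ell)$ of elements of $G$ (repetitions allowed), of length $|S|=\ell$. $S$ is zero-sumfree if $\sum_{i\in I} g_i \neq 0$ for every non-empty $I \subseteq \{1,\dots,\ell\}$. The cross number of $S$ is $\mathsf{k}(S)=\sum_{i=1}^{\ell} \frac{1}{\mathrm{ord}(g_i)}$. -}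

module Defs where

open import Data.Nat using (ℕ; zero; suc; _+_; _*_; _∸_)
open import Data.Nat.Divisibility using (_∣_; _∣?_)
open import Data.Fin using (Fin; zero; suc)
open import Data.Fin.Properties using (all?)
open import Data.Bool using (Bool; true; false; if_then_else_)
open import Data.Product using (∃)
open import Relation.Nullary using (¬_; does)
open import Relation.Binary.PropositionalEquality using (_≡_)
open import Data.Integer using (+_)
open import Data.Rational using (ℚ; 0ℚ; _/_) renaming (_+_ to _+ℚ_)

Σℕ : ∀ {m} → (Fin m → ℕ) → ℕ
Σℕ {zero}  f = 0
Σℕ {suc m} f = f zero + Σℕ (λ i → f (suc i))

Σℚ : ∀ {m} → (Fin m → ℚ) → ℚ
Σℚ {zero}  f = 0ℚ
Σℚ {suc m} f = f zero +ℚ Σℚ (λ i → f (suc i))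

Πℕ : ∀ {m} → (Fin m → ℕ) → ℕ
Πℕ {zero}  f = 1
Πℕ {suc m} f = f zero * Πℕ (λ i → f (suc i))

-- The rational a / b (with the junk value 0 when b = 0; never used with b = 0).
frac : ℕ → ℕ → ℚ
frac a zero    = 0ℚ
frac a (suc b) = (+ a) / suc b

-- The group G = C_{n_0} ⊕ … ⊕ C_{n_{r-1}}: an element is represented by a
-- tuple g : Fin r → ℕ of representatives, g c taken modulo n c.
Elem : ℕ → Set
Elem r = Fin r → ℕ

IsZero : ∀ {r} → (n : Fin r → ℕ) → Elem r → Set
IsZero n g = ∀ c → n c ∣ g c

isZero? : ∀ {r} (n : Fin r → ℕ) (g : Elem r) → Bool
isZero? n g = does (all? (λ c → n c ∣? g c))

_·_ : ∀ {r} → ℕ → Elem r → Elem r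
(k · g) c = k * g c

ordSearch : ∀ {r} (n : Fin r → ℕ) (g : Elem r) → (fuel k : ℕ) → ℕ
ordSearch n g zero       k = 0
ordSearch n g (suc fuel) k =
  if isZero? n (k · g) then k else ordSearch n g fuel (suc k)

-- ord(g) = least k ≥ 1 with k · g = 0.  Since (∏ n_i) · g = 0, searching
-- k = 1, …, ∏ n_i finds it.
ord : ∀ {r} (n : Fin r → ℕ) (g : Elem r) → ℕ
ord n g = ordSearch n g (Πℕ n) 1

Seq : ℕ → ℕ → Set
Seq r ℓ = Fin ℓ → Elem r

subSum : ∀ {r ℓ} → Seq r ℓ → (Fin ℓ → Bool) → Elem r
subSum S I c = Σℕ (λ j → if I j then S j c else 0)

ZeroSumFree : ∀ {r ℓ} → (n : Fin r → ℕ) → Seq r ℓ → Set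
ZeroSumFree n S = ∀ (I : _ → Bool) → ∃ (λ j → I j ≡ true) → ¬ IsZero n (subSum S I)

crossNumber : ∀ {r ℓ} → (n : Fin r → ℕ) → Seq r ℓ → ℚ
crossNumber n S = Σℚ (λ j → frac 1 (ord n (S j)))

module Submission where

open import Defs
open import Data.Nat using (ℕ; _<_; _≤_; _∸_; _^_)
open import Data.Nat.Divisibility using (_∣_)
open import Data.Nat.Primality using (Prime)
open import Data.Fin using (Fin; toℕ)
open import Data.Product using (_×_; ∃)
open import Data.Sum using (_⊎_)
open import Relation.Binary.PropositionalEquality using (_≡_)
open import Data.Rational using () renaming (_≤_ to _≤ℚ_)

-- p-group case (no length hypothesis needed): with N = Π_i n_i, ω_i = N/n_i and
-- u(g) = N/ord(g) it suffices that Σ_j u(S_j) ≤ Σ_i (n_i - 1)·ω_i.  This follows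
-- from a binomial form of Olson's polynomial method: the alternating sums
-- M S a = Σ_{I ⊆ S} (-1)^|I| Π_i C(σ_I(S)_i, a_i) are divisible by p when
-- Σ_i a_i ω_i < Σ_j u(S_j), yet the shifted sum at a = n - 1 is ≡ 1 modulo p.
-- Cyclic case G = C_m: sums of nested subsequences are incongruent modulo m, so
-- |S| = m - 1; then all terms are congruent, hence generators, and k(S) = (m-1)/m.

module Binomial where

  open import Data.Nat
  open import Data.Nat.Properties
  open import Data.Nat.Combinatorics using (_C_; nCk+nC[k+1]≡[n+1]C[k+1]; nCk≡nC[n∸k]; nC1≡n; k>n⇒nCk≡0)
  open import Data.Nat.Solver using (module +-*-Solver)
  open +-*-Solver using (solve; _:+_; _:*_; _:=_; con)
  open import Relation.Binary.PropositionalEquality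

  pascal : ∀ n k → suc n C suc k ≡ n C k + n C suc k
  pascal n k = sym (nCk+nC[k+1]≡[n+1]C[k+1] n k)

  absorption : ∀ n k → suc k * (suc n C suc k) ≡ suc n * (n C k)
  absorption zero    zero    = refl
  absorption zero    (suc k) = trans (cong (suc (suc k) *_) (k>n⇒nCk≡0 (s≤s (s≤s (z≤n {k})))))
                                     (*-zeroʳ (suc (suc k)))
  absorption (suc n) zero    = trans (*-identityˡ _) (trans (nC1≡n (suc (suc n))) (sym (*-identityʳ _)))
  absorption (suc n) (suc k) = begin
    (2 + k) * ((2 + n) C (2 + k))    ≡⟨ cong ((2 + k) *_) (pascal (suc n) (suc k)) ⟩
    (2 + k) * (A + B)                ≡⟨ split-k ⟩
    ((1 + k) * A + A) + (2 + k) * B  ≡⟨ cong₂ (λ u v → (u + A) + v) (absorption n k) (absorption n (suc k)) ⟩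
    ((1 + n) * x + A) + (1 + n) * y  ≡⟨ collect-n ⟩
    (1 + n) * (x + y) + A            ≡⟨ cong (λ z → (1 + n) * z + A) (pascal n k) ⟨
    (1 + n) * A + A                  ≡⟨ solve 2 (λ n A → (con 1 :+ n) :* A :+ A := (con 2 :+ n) :* A) refl n A ⟩
    (2 + n) * A                      ∎
    where
    open ≡-Reasoning
    A = suc n C suc k
    B = suc n C suc (suc k)
    x = n C k
    y = n C suc k
    split-k : (2 + k) * (A + B) ≡ ((1 + k) * A + A) + (2 + k) * B
    split-k = solve 3 (λ k A B → (con 2 :+ k) :* (A :+ B) := ((con 1 :+ k) :* A :+ A) :+ (con 2 :+ k) :* B)
                    refl k A B
    collect-n : ((1 + n) * x + A) + (1 + n) * y ≡ (1 + n) * (x + y) + A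
    collect-n = solve 4 (λ n x y A → ((con 1 :+ n) :* x :+ A) :+ (con 1 :+ n) :* y := (con 1 :+ n) :* (x :+ y) :+ A)
                      refl n x y A

  complement : ∀ a b → (a + b) C a ≡ (a + b) C b
  complement a b = trans (nCk≡nC[n∸k] (m≤m+n a b)) (cong ((a + b) C_) (m+n∸m≡n a b))

  shift : ∀ m σ → σ * ((m + σ) C m) ≡ suc m * ((m + σ) C suc m)
  shift m zero    = sym (trans (cong (suc m *_) (k>n⇒nCk≡0 (s≤s (≤-reflexive (+-identityʳ m)))))
                               (*-zeroʳ (suc m)))
  shift m (suc s) = begin
    suc s * ((m + suc s) C m)         ≡⟨ cong (suc s *_) (complement m (suc s)) ⟩
    suc s * ((m + suc s) C suc s)     ≡⟨ cong (λ n → suc s * (n C suc s)) (+-suc m s) ⟩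
    suc s * (suc (m + s) C suc s)   ≡⟨ absorption (m + s) s ⟩
    suc (m + s) * ((m + s) C s)       ≡⟨ cong (suc (m + s) *_) (complement m s) ⟨
    suc (m + s) * ((m + s) C m)       ≡⟨ absorption (m + s) m ⟨
    suc m * (suc (m + s) C suc m)   ≡⟨ cong (λ n → suc m * (n C suc m)) (+-suc m s) ⟨
    suc m * ((m + suc s) C suc m)     ∎
    where open ≡-Reasoning

module PrimePower {p : ℕ} (prime : Prime p) where

  open import Data.Nat
  open import Data.Nat.Properties
  open import Data.Nat.Divisibility
  open import Data.Nat.Primality using (prime⇒nonZero; prime⇒irreducible; euclidsLemma)
  open import Data.Nat.Coprimality using (Coprime; coprime-divisor)
  open import Data.Nat.Combinatorics using (_C_)
  open import Algebra.Properties.CommutativeSemigroup *-commutativeSemigroup using (xy∙z≈xz∙y)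
  open import Data.Product using (_,_)
  open import Data.Sum using (inj₁; inj₂)
  open import Data.Empty using (⊥-elim)
  open import Relation.Nullary using (¬_; yes; no)
  open import Relation.Binary.PropositionalEquality
  open Binomial

  private instance
    p≢0 : NonZero p
    p≢0 = prime⇒nonZero prime

  -- A divisor d of a power of p cannot share a factor with X when p ∤ X, so
  -- d ∣ t·X forces d ∣ t.  Induction on e: either p ∣ d, and one factor p is
  -- cancelled from d and t, or d is coprime to p and already divides p^(e-1).
  primePower-cancel : ∀ e {d t X} → d ∣ p ^ e → ¬ p ∣ X → d ∣ t * X → d ∣ t
  primePower-cancel zero    d∣1 _ _ rewrite ∣1⇒≡1 d∣1 = 1∣ _
  primePower-cancel (suc e) {d} {t} {X} d∣pe p∤X d∣tX with p ∣? d
  ... | no p∤d = primePower-cancel e (coprime-divisor d⊥p d∣pe) p∤X d∣tX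
    where
    d⊥p : Coprime d p
    d⊥p (i∣d , i∣p) with prime⇒irreducible prime i∣p
    ... | inj₁ i≡1 = i≡1
    ... | inj₂ refl = ⊥-elim (p∤d i∣d)
  ... | yes (divides d′ refl) with euclidsLemma t X prime (∣-trans (n∣m*n d′) d∣tX)
  ...   | inj₂ p∣X = ⊥-elim (p∤X p∣X)
  ...   | inj₁ (divides t′ refl) = *-monoˡ-∣ {d′} {t′} p (primePower-cancel e d′∣pe p∤X d′∣t′X)
    where
    d′∣pe : d′ ∣ p ^ e
    d′∣pe = *-cancelʳ-∣ p (subst (d′ * p ∣_) (*-comm p (p ^ e)) d∣pe)
    d′∣t′X : d′ ∣ t′ * X
    d′∣t′X = *-cancelʳ-∣ p (subst (d′ * p ∣_) (xy∙z≈xz∙y t′ p X) d∣tX)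

  -- If p ∤ C(g, c) with c > 0, then a divisor d of p^e with d ∣ q·g divides
  -- q·c: by absorption c·C(g, c) = g·C(g-1, c-1) is a multiple of g.
  binomial-absorb-∣ : ∀ e {d q g c} → d ∣ p ^ e → ¬ p ∣ (g C c) → 0 < c → d ∣ q * g → d ∣ q * c
  binomial-absorb-∣ e {g = zero}  {suc c} _ p∤C _ _ = ⊥-elim (p∤C (p ∣0))
  binomial-absorb-∣ e {d} {q} {suc g} {suc c} d∣pe p∤C _ d∣qg =
    primePower-cancel e d∣pe p∤C (subst (d ∣_) reassociate (∣m⇒∣m*n (g C c) d∣qg))
    where
    open ≡-Reasoning
    reassociate : q * suc g * (g C c) ≡ q * suc c * (suc g C suc c)
    reassociate = begin
      q * suc g * (g C c)             ≡⟨ *-assoc q (suc g) _ ⟩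
      q * (suc g * (g C c))           ≡⟨ cong (q *_) (absorption g c) ⟨
      q * (suc c * (suc g C suc c))   ≡⟨ *-assoc q (suc c) _ ⟨
      q * suc c * (suc g C suc c)     ∎

  -- If m + 1 divides p^e and p ∤ C(m+σ, m), then m + 1 divides σ:
  -- σ·C(m+σ, m) = (m+1)·C(m+σ, m+1) is a multiple of m + 1.
  binomial-shift-∣ : ∀ e {m σ} → suc m ∣ p ^ e → ¬ p ∣ ((m + σ) C m) → suc m ∣ σ
  binomial-shift-∣ e {m} {σ} m+1∣pe p∤C =
    primePower-cancel e m+1∣pe p∤C (subst (suc m ∣_) (sym (shift m σ)) (m∣m*n _))

module IntegerSums where

  open import Data.Nat as ℕ using (zero; suc)
  open import Data.Nat.Combinatorics using (_C_)
  open import Data.Integer using (ℤ; +_; 0ℤ; 1ℤ; -1ℤ; _+_; _*_; -_; _-_)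
  open import Data.Integer.Properties
  open import Data.Integer.Divisibility.Signed
    using (divides; ∣m∣n⇒∣m+n; ∣m∣n⇒∣m-n; ∣m⇒∣-m; ∣n⇒∣m*n; ∣m⇒∣m*n) renaming (_∣_ to _∣ℤ_)
  open import Data.Integer.Solver using (module +-*-Solver)
  open +-*-Solver using (solve; _:+_; _:*_; :-_; _:=_)
  open import Data.Fin using (Fin; zero; suc)
  open import Data.Vec.Functional using ([]; _∷_)
  open import Data.Bool using (Bool; true; false; if_then_else_)
  open import Data.Product using (∃; _,_)
  open import Relation.Binary.PropositionalEquality
  open import Function using (_∘_)
  open Binomial using (pascal)

  ∣0 : ∀ {d} → d ∣ℤ 0ℤ
  ∣0 {d} = divides 0ℤ (sym (*-zeroˡ d))

  -- Congruence modulo d (a record, so that x, y and d can be inferred).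
  infix 4 _≡_mod_
  record _≡_mod_ (x y d : ℤ) : Set where
    constructor mod-by
    field difference : d ∣ℤ (x - y)

  ≡⇒mod : ∀ {d x y} → x ≡ y → x ≡ y mod d
  ≡⇒mod {d} {x} refl = mod-by (subst (d ∣ℤ_) (sym (+-inverseʳ x)) ∣0)

  mod-trans : ∀ {d x y z} → x ≡ y mod d → y ≡ z mod d → x ≡ z mod d
  mod-trans {d} {x} {y} {z} (mod-by x≡y) (mod-by y≡z) =
    mod-by (subst (d ∣ℤ_) (+-minus-telescope x y z) (∣m∣n⇒∣m+n x≡y y≡z))

  mod-sym : ∀ {d x y} → x ≡ y mod d → y ≡ x mod d
  mod-sym {d} {x} {y} (mod-by x≡y) =
    mod-by (subst (d ∣ℤ_) (solve 2 (λ x y → :- (x :+ :- y) := y :+ :- x) refl x y) (∣m⇒∣-m x≡y))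

  +-mod : ∀ {d} x {y} → d ∣ℤ y → x + y ≡ x mod d
  +-mod {d} x {y} d∣y = mod-by (subst (d ∣ℤ_) (solve 2 (λ x y → y := x :+ y :+ :- x) refl x y) d∣y)

  mod-∣ : ∀ {d x y} → x ≡ y mod d → d ∣ℤ x → d ∣ℤ y
  mod-∣ {d} {x} {y} (mod-by x≡y) d∣x =
    subst (d ∣ℤ_) (solve 2 (λ x y → x :+ :- (x :+ :- y) := y) refl x y) (∣m∣n⇒∣m-n d∣x x≡y)

  ∏ : ∀ {r} → (Fin r → ℤ) → ℤ
  ∏ {zero}  f = 1ℤ
  ∏ {suc r} f = f zero * ∏ (f ∘ suc)

  ∏-cong : ∀ {r} {f g : Fin r → ℤ} → (∀ i → f i ≡ g i) → ∏ f ≡ ∏ g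
  ∏-cong {zero}  f≗g = refl
  ∏-cong {suc r} f≗g = cong₂ _*_ (f≗g zero) (∏-cong (f≗g ∘ suc))

  ∏-ones : ∀ {r} {f : Fin r → ℤ} → (∀ i → f i ≡ 1ℤ) → ∏ f ≡ 1ℤ
  ∏-ones {zero}  f≗1 = refl
  ∏-ones {suc r} f≗1 = trans (cong₂ _*_ (f≗1 zero) (∏-ones (f≗1 ∘ suc))) (*-identityˡ 1ℤ)

  ∏-∣ : ∀ {d r} {f : Fin r → ℤ} → (∃ λ i → d ∣ℤ f i) → d ∣ℤ ∏ f
  ∏-∣ {r = suc r} {f} (zero  , d∣fi) = ∣m⇒∣m*n (∏ (f ∘ suc)) d∣fi
  ∏-∣ {r = suc r} {f} (suc i , d∣fi) = ∣n⇒∣m*n (f zero) (∏-∣ (i , d∣fi))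

  -- conv k G = Σ_{b + c = k} G b c, summed from b = 0 upwards; it is
  -- congruent, additive and homogeneous in G.
  conv : ℕ → (ℕ → ℕ → ℤ) → ℤ
  conv zero    G = G 0 0
  conv (suc k) G = G 0 (suc k) + conv k (λ b c → G (suc b) c)

  conv-cong : ∀ k {G H} → (∀ b c → G b c ≡ H b c) → conv k G ≡ conv k H
  conv-cong zero    G≗H = G≗H 0 0
  conv-cong (suc k) G≗H = cong₂ _+_ (G≗H 0 (suc k)) (conv-cong k (λ b → G≗H (suc b)))

  conv-+ : ∀ k G H → conv k (λ b c → G b c + H b c) ≡ conv k G + conv k H
  conv-+ zero    G H = refl
  conv-+ (suc k) G H =
    trans (cong (_+_ (G 0 (suc k) + H 0 (suc k))) (conv-+ k (λ b → G (suc b)) (λ b → H (suc b))))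
          (solve 4 (λ a b c d → (a :+ b) :+ (c :+ d) := (a :+ c) :+ (b :+ d)) refl
                 (G 0 (suc k)) (H 0 (suc k)) (conv k (λ b → G (suc b))) (conv k (λ b → H (suc b))))

  conv-*ˡ : ∀ k x G → conv k (λ b c → x * G b c) ≡ x * conv k G
  conv-*ˡ zero    x G = refl
  conv-*ˡ (suc k) x G = trans (cong (_+_ (x * G 0 (suc k))) (conv-*ˡ k x (λ b → G (suc b))))
                              (sym (*-distribˡ-+ x _ _))

  conv-zero : ∀ k {G} → (∀ b c → G b c ≡ 0ℤ) → conv k G ≡ 0ℤ
  conv-zero zero    G≗0 = G≗0 0 0
  conv-zero (suc k) G≗0 = cong₂ _+_ (G≗0 0 (suc k)) (conv-zero k (λ b → G≗0 (suc b)))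

  vandermonde : ∀ x y k → + ((x ℕ.+ y) C k) ≡ conv k (λ b c → + (x C b) * + (y C c))
  vandermonde zero    y zero    = refl
  vandermonde zero    y (suc k) = sym (trans
    (cong₂ _+_ (*-identityˡ (+ (y C suc k))) (conv-zero k (λ _ _ → refl))) (+-identityʳ (+ (y C suc k))))
  vandermonde (suc x) y zero    = refl
  vandermonde (suc x) y (suc k) = begin
    + (suc (x ℕ.+ y) C suc k)                  ≡⟨ cong +_ (pascal (x ℕ.+ y) k) ⟩
    + ((x ℕ.+ y) C k ℕ.+ (x ℕ.+ y) C suc k)    ≡⟨ pos-+ ((x ℕ.+ y) C k) _ ⟩
    + ((x ℕ.+ y) C k) + + ((x ℕ.+ y) C suc k)  ≡⟨ cong₂ _+_ (vandermonde x y k) (vandermonde x y (suc k)) ⟩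
    conv k G + (G 0 (suc k) + conv k G⁺)        ≡⟨ x+[y+z]≡y+[x+z] (conv k G) (G 0 (suc k)) (conv k G⁺) ⟩
    G 0 (suc k) + (conv k G + conv k G⁺)        ≡⟨ cong (_+_ (G 0 (suc k))) (conv-+ k G G⁺) ⟨
    G 0 (suc k) + conv k (λ b c → G b c + G⁺ b c) ≡⟨ cong (_+_ (G 0 (suc k))) (conv-cong k pascal-term) ⟨
    G′ 0 (suc k) + conv k (λ b c → G′ (suc b) c) ∎
    where
    open ≡-Reasoning
    G G⁺ G′ : ℕ → ℕ → ℤ
    G  b c = + (x C b) * + (y C c)
    G⁺ b c = G (suc b) c
    G′ b c = + (suc x C b) * + (y C c)
    x+[y+z]≡y+[x+z] : ∀ x y z → x + (y + z) ≡ y + (x + z)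
    x+[y+z]≡y+[x+z] = solve 3 (λ x y z → x :+ (y :+ z) := y :+ (x :+ z)) refl
    pascal-term : ∀ b c → G′ (suc b) c ≡ G b c + G⁺ b c
    pascal-term b c = begin
      + (suc x C suc b) * + (y C c)               ≡⟨ cong (λ z → + z * + (y C c)) (pascal x b) ⟩
      + (x C b ℕ.+ x C suc b) * + (y C c)         ≡⟨ cong (_* + (y C c)) (pos-+ (x C b) _) ⟩
      (+ (x C b) + + (x C suc b)) * + (y C c)     ≡⟨ *-distribʳ-+ (+ (y C c)) (+ (x C b)) (+ (x C suc b)) ⟩
      G b c + G⁺ b c                              ∎

  conv-∣ : ∀ {d} k {G} → (∀ b c → b ℕ.+ c ≡ k → d ∣ℤ G b c) → d ∣ℤ conv k G
  conv-∣ zero    d∣G = d∣G 0 0 refl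
  conv-∣ (suc k) d∣G = ∣m∣n⇒∣m+n (d∣G 0 (suc k) refl) (conv-∣ k (λ b c e → d∣G (suc b) c (cong suc e)))

  conv-mod : ∀ {d} k {G} → (∀ b c → suc b ℕ.+ c ≡ k → d ∣ℤ G (suc b) c) → conv k G ≡ G 0 k mod d
  conv-mod zero    _   = ≡⇒mod refl
  conv-mod (suc k) d∣G = +-mod _ (conv-∣ k (λ b c e → d∣G b c (cong suc e)))

  -- Conv a F = Σ_{b + c = a} F b c over pairs of multi-indices b, c : Fin r → ℕ,
  -- an iterated one-dimensional convolution; it inherits the properties of conv.
  Conv : ∀ {r} → (Fin r → ℕ) → ((Fin r → ℕ) → (Fin r → ℕ) → ℤ) → ℤ
  Conv {zero}  a F = F [] []
  Conv {suc r} a F = conv (a zero) (λ b₀ c₀ → Conv (a ∘ suc) (λ b c → F (b₀ ∷ b) (c₀ ∷ c)))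

  Conv-cong : ∀ {r} (a : Fin r → ℕ) {F H} → (∀ b c → F b c ≡ H b c) → Conv a F ≡ Conv a H
  Conv-cong {zero}  a F≗H = F≗H [] []
  Conv-cong {suc r} a F≗H =
    conv-cong (a zero) (λ b₀ c₀ → Conv-cong (a ∘ suc) (λ b c → F≗H (b₀ ∷ b) (c₀ ∷ c)))

  Conv-+ : ∀ {r} (a : Fin r → ℕ) F H → Conv a (λ b c → F b c + H b c) ≡ Conv a F + Conv a H
  Conv-+ {zero}  a F H = refl
  Conv-+ {suc r} a F H = trans
    (conv-cong (a zero) (λ b₀ c₀ →
      Conv-+ (a ∘ suc) (λ b c → F (b₀ ∷ b) (c₀ ∷ c)) (λ b c → H (b₀ ∷ b) (c₀ ∷ c))))
    (conv-+ (a zero) _ _)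

  Conv-*ˡ : ∀ {r} (a : Fin r → ℕ) x F → Conv a (λ b c → x * F b c) ≡ x * Conv a F
  Conv-*ˡ {zero}  a x F = refl
  Conv-*ˡ {suc r} a x F = trans
    (conv-cong (a zero) (λ b₀ c₀ → Conv-*ˡ (a ∘ suc) x (λ b c → F (b₀ ∷ b) (c₀ ∷ c))))
    (conv-*ˡ (a zero) x _)

  Conv-∣ : ∀ {d r} (a : Fin r → ℕ) {F}
    → (∀ b c → (∀ i → b i ℕ.+ c i ≡ a i) → d ∣ℤ F b c) → d ∣ℤ Conv a F
  Conv-∣ {r = zero}  a d∣F = d∣F [] [] (λ ())
  Conv-∣ {r = suc r} a d∣F = conv-∣ (a zero) (λ b₀ c₀ e₀ →
    Conv-∣ (a ∘ suc) (λ b c e → d∣F (b₀ ∷ b) (c₀ ∷ c) (λ { zero → e₀ ; (suc i) → e i })))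

  -- Modulo d, Conv a F is its term at (b, c) = (0, a) when all terms with b ≠ 0
  -- vanish; that term is given as v to avoid comparing functions.
  Conv-mod : ∀ {d r} (a : Fin r → ℕ) {F} v
    → (∀ b c → (∀ i → b i ≡ 0) → (∀ i → c i ≡ a i) → F b c ≡ v)
    → (∀ b c → (∀ i → b i ℕ.+ c i ≡ a i) → (∃ λ i → 0 < b i) → d ∣ℤ F b c)
    → Conv a F ≡ v mod d
  Conv-mod {r = zero}  a v F[0,a]≡v _ = ≡⇒mod (F[0,a]≡v [] [] (λ ()) (λ ()))
  Conv-mod {r = suc r} a v F[0,a]≡v d∣F = mod-trans
    (conv-mod (a zero) (λ b₀ c₀ e₀ → Conv-∣ (a ∘ suc) (λ b c e →
      d∣F (suc b₀ ∷ b) (c₀ ∷ c) (λ { zero → e₀ ; (suc i) → e i }) (zero , ℕ.s≤s ℕ.z≤n))))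
    (Conv-mod (a ∘ suc) v
      (λ b c b≗0 c≗a → F[0,a]≡v (0 ∷ b) (a zero ∷ c) (λ { zero → refl ; (suc i) → b≗0 i })
                                                      (λ { zero → refl ; (suc i) → c≗a i }))
      (λ b c e (i , 0<bᵢ) → d∣F (0 ∷ b) (a zero ∷ c) (λ { zero → refl ; (suc i) → e i }) (suc i , 0<bᵢ)))

  ∏-conv : ∀ {r} (a : Fin r → ℕ) (f g : Fin r → ℕ → ℤ)
    → ∏ (λ i → conv (a i) (λ b c → f i b * g i c))
      ≡ Conv a (λ b c → ∏ (λ i → f i (b i)) * ∏ (λ i → g i (c i)))
  ∏-conv {zero}  a f g = refl
  ∏-conv {suc r} a f g = begin
    conv₀ (λ b₀ c₀ → f₀ b₀ * g₀ c₀) * ∏ (λ i → conv (a (suc i)) (λ b c → f (suc i) b * g (suc i) c))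
      ≡⟨ cong (conv₀ (λ b₀ c₀ → f₀ b₀ * g₀ c₀) *_) (∏-conv (a ∘ suc) (f ∘ suc) (g ∘ suc)) ⟩
    conv₀ (λ b₀ c₀ → f₀ b₀ * g₀ c₀) * R
      ≡⟨ *-comm _ R ⟩
    R * conv₀ (λ b₀ c₀ → f₀ b₀ * g₀ c₀)
      ≡⟨ conv-*ˡ (a zero) R _ ⟨
    conv₀ (λ b₀ c₀ → R * (f₀ b₀ * g₀ c₀))
      ≡⟨ conv-cong (a zero) (λ b₀ c₀ → trans (*-comm R _) (sym (Conv-*ˡ (a ∘ suc) (f₀ b₀ * g₀ c₀) _))) ⟩
    conv₀ (λ b₀ c₀ → Conv (a ∘ suc) (λ b c → (f₀ b₀ * g₀ c₀) * (f′ b * g′ c)))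
      ≡⟨ conv-cong (a zero) (λ b₀ c₀ → Conv-cong (a ∘ suc) (λ b c → interchange (f₀ b₀) (g₀ c₀) _ _)) ⟩
    Conv a (λ b c → ∏ (λ i → f i (b i)) * ∏ (λ i → g i (c i)))
      ∎
    where
    open ≡-Reasoning
    conv₀ = conv (a zero)
    f₀ = f zero
    g₀ = g zero
    f′ g′ : (Fin r → ℕ) → ℤ
    f′ b = ∏ (λ i → f (suc i) (b i))
    g′ c = ∏ (λ i → g (suc i) (c i))
    R = Conv (a ∘ suc) (λ b c → f′ b * g′ c)
    interchange : ∀ x y X Y → (x * y) * (X * Y) ≡ (x * X) * (y * Y)
    interchange = solve 4 (λ x y X Y → (x :* y) :* (X :* Y) := (x :* X) :* (y :* Y)) refl

  ΣI : ∀ {ℓ} → ((Fin ℓ → Bool) → ℤ) → ℤ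
  ΣI {zero}  F = F []
  ΣI {suc ℓ} F = ΣI (λ I → F (false ∷ I)) + ΣI (λ I → F (true ∷ I))

  sign : ∀ {ℓ} → (Fin ℓ → Bool) → ℤ
  sign {zero}  I = 1ℤ
  sign {suc ℓ} I = if I zero then - sign (I ∘ suc) else sign (I ∘ suc)

  sign-∅ : ∀ {ℓ} (I : Fin ℓ → Bool) → (∀ j → I j ≡ false) → sign I ≡ 1ℤ
  sign-∅ {zero}  I I≗∅ = refl
  sign-∅ {suc ℓ} I I≗∅ with I zero | I≗∅ zero
  ... | false | refl = sign-∅ (I ∘ suc) (I≗∅ ∘ suc)

  ΣI-cong : ∀ {ℓ} {F H : (Fin ℓ → Bool) → ℤ} → (∀ I → F I ≡ H I) → ΣI F ≡ ΣI H
  ΣI-cong {zero}  F≗H = F≗H []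
  ΣI-cong {suc ℓ} F≗H = cong₂ _+_ (ΣI-cong (λ I → F≗H (false ∷ I))) (ΣI-cong (λ I → F≗H (true ∷ I)))

  ΣI-*ˡ : ∀ {ℓ} x (F : (Fin ℓ → Bool) → ℤ) → ΣI (λ I → x * F I) ≡ x * ΣI F
  ΣI-*ˡ {zero}  x F = refl
  ΣI-*ˡ {suc ℓ} x F = trans (cong₂ _+_ (ΣI-*ˡ x (λ I → F (false ∷ I))) (ΣI-*ˡ x (λ I → F (true ∷ I))))
                            (sym (*-distribˡ-+ x _ _))

  ΣI-neg : ∀ {ℓ} (F : (Fin ℓ → Bool) → ℤ) → ΣI (λ I → - F I) ≡ - ΣI F
  ΣI-neg F = trans (ΣI-cong (λ I → sym (-1*i≡-i (F I)))) (trans (ΣI-*ˡ -1ℤ F) (-1*i≡-i (ΣI F)))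

  ΣI-Conv : ∀ {ℓ r} (a : Fin r → ℕ) (F : (Fin ℓ → Bool) → (Fin r → ℕ) → (Fin r → ℕ) → ℤ)
    → ΣI (λ I → Conv a (F I)) ≡ Conv a (λ b c → ΣI (λ I → F I b c))
  ΣI-Conv {zero}  a F = refl
  ΣI-Conv {suc ℓ} a F = trans (cong₂ _+_ (ΣI-Conv a (λ I → F (false ∷ I))) (ΣI-Conv a (λ I → F (true ∷ I))))
                              (sym (Conv-+ a _ _))

  ΣI-∣ : ∀ {d ℓ} {F : (Fin ℓ → Bool) → ℤ} → (∀ I → d ∣ℤ F I) → d ∣ℤ ΣI F
  ΣI-∣ {ℓ = zero}  d∣F = d∣F []
  ΣI-∣ {ℓ = suc ℓ} d∣F = ∣m∣n⇒∣m+n (ΣI-∣ (λ I → d∣F (false ∷ I))) (ΣI-∣ (λ I → d∣F (true ∷ I)))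

  ΣI-mod : ∀ {d ℓ} {F : (Fin ℓ → Bool) → ℤ} v
    → (∀ I → (∀ j → I j ≡ false) → F I ≡ v)
    → (∀ I → (∃ λ j → I j ≡ true) → d ∣ℤ F I)
    → ΣI F ≡ v mod d
  ΣI-mod {ℓ = zero}  v F∅≡v _ = ≡⇒mod (F∅≡v [] (λ ()))
  ΣI-mod {ℓ = suc ℓ} {F} v F∅≡v d∣F = mod-trans
    (+-mod (ΣI (λ I → F (false ∷ I))) (ΣI-∣ (λ I → d∣F (true ∷ I) (zero , refl))))
    (ΣI-mod v (λ I I≗∅ → F∅≡v (false ∷ I) (λ { zero → refl ; (suc j) → I≗∅ j }))
              (λ I (j , Iⱼ) → d∣F (false ∷ I) (suc j , Iⱼ)))

module NatSums where

  open import Data.Nat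
  open import Data.Nat.Properties
  open import Data.Nat.Divisibility using (_∣_; m∣m*n; ∣n⇒∣m*n)
  open import Data.Fin using (Fin; zero; suc)
  import Data.Fin.Properties as Fin
  open import Data.Bool using (Bool; false; if_then_else_)
  open import Relation.Binary.PropositionalEquality
  open import Function using (_∘_)
  open import Algebra.Properties.CommutativeSemigroup +-commutativeSemigroup using (interchange)

  Σℕ-cong : ∀ {m} {f g : Fin m → ℕ} → (∀ i → f i ≡ g i) → Σℕ f ≡ Σℕ g
  Σℕ-cong {zero}  f≗g = refl
  Σℕ-cong {suc m} f≗g = cong₂ _+_ (f≗g zero) (Σℕ-cong (f≗g ∘ suc))

  Σℕ-+ : ∀ {m} (f g : Fin m → ℕ) → Σℕ (λ i → f i + g i) ≡ Σℕ f + Σℕ g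
  Σℕ-+ {zero}  f g = refl
  Σℕ-+ {suc m} f g = trans (cong (f zero + g zero +_) (Σℕ-+ (f ∘ suc) (g ∘ suc)))
                           (interchange (f zero) (g zero) _ _)

  Σℕ-mono : ∀ {m} {f g : Fin m → ℕ} → (∀ i → f i ≤ g i) → Σℕ f ≤ Σℕ g
  Σℕ-mono {zero}  f≤g = z≤n
  Σℕ-mono {suc m} f≤g = +-mono-≤ (f≤g zero) (Σℕ-mono (f≤g ∘ suc))

  term≤Σℕ : ∀ {m} (f : Fin m → ℕ) i → f i ≤ Σℕ f
  term≤Σℕ f zero    = m≤m+n _ _
  term≤Σℕ f (suc i) = ≤-trans (term≤Σℕ (f ∘ suc) i) (m≤n+m _ (f zero))

  Σℕ-zero : ∀ {m} {f : Fin m → ℕ} → (∀ i → f i ≡ 0) → Σℕ f ≡ 0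
  Σℕ-zero {zero}  f≗0 = refl
  Σℕ-zero {suc m} f≗0 = cong₂ _+_ (f≗0 zero) (Σℕ-zero (f≗0 ∘ suc))

  Σℕ-point : ∀ {m} (f : Fin m → ℕ) y → (∀ x → x ≢ y → f x ≡ 0) → Σℕ f ≡ f y
  Σℕ-point {suc m} f zero    f≗0 = trans (cong (f zero +_) (Σℕ-zero (λ x → f≗0 (suc x) (λ ())))) (+-identityʳ _)
  Σℕ-point {suc m} f (suc y) f≗0 = trans (cong (_+ Σℕ (f ∘ suc)) (f≗0 zero (λ ())))
    (Σℕ-point (f ∘ suc) y (λ x x≢y → f≗0 (suc x) (x≢y ∘ Fin.suc-injective)))

  Σℕ-const : ∀ {m} c → Σℕ {m} (λ _ → c) ≡ m * c
  Σℕ-const {zero}  c = refl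
  Σℕ-const {suc m} c = cong (c +_) (Σℕ-const {m} c)

  subSum-∅ : ∀ {r ℓ} (S : Seq r ℓ) (I : Fin ℓ → Bool) → (∀ j → I j ≡ false) → ∀ i → subSum S I i ≡ 0
  subSum-∅ S I I≗∅ i = Σℕ-zero (λ j → cong (λ b → if b then S j i else 0) (I≗∅ j))

  Πℕ-pos : ∀ {m} {f : Fin m → ℕ} → (∀ i → 0 < f i) → 0 < Πℕ f
  Πℕ-pos {zero}  _   = s≤s z≤n
  Πℕ-pos {suc m} f>0 = *-mono-≤ (f>0 zero) (Πℕ-pos (f>0 ∘ suc))

  factor∣Πℕ : ∀ {m} (f : Fin m → ℕ) i → f i ∣ Πℕ f
  factor∣Πℕ f zero    = m∣m*n _
  factor∣Πℕ f (suc i) = ∣n⇒∣m*n (f zero) (factor∣Πℕ (f ∘ suc) i)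

module AlternatingSums where

  open import Data.Nat as ℕ using (zero; suc)
  open import Data.Nat.Combinatorics using (_C_)
  open import Data.Integer using (ℤ; +_; _+_; _*_; -_; _-_)
  open import Data.Integer.Properties using (neg-distribˡ-*)
  open import Data.Integer.Solver using (module +-*-Solver)
  open +-*-Solver using (solve; _:*_; _:=_)
  open import Data.Fin using (Fin; zero; suc)
  open import Data.Bool using (Bool)
  open import Relation.Binary.PropositionalEquality
  open import Function using (_∘_)
  open IntegerSums

  alternating : ∀ {r ℓ} → Seq r ℓ → Elem r → (Fin r → ℕ) → ℤ
  alternating S g a = ΣI (λ I → sign I * ∏ (λ i → + ((g i ℕ.+ subSum S I i) C a i)))

  M : ∀ {r ℓ} → Seq r ℓ → (Fin r → ℕ) → ℤ
  M S = alternating S (λ _ → 0)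

  M-cong : ∀ {r ℓ} (S : Seq r ℓ) {a a′} → (∀ i → a i ≡ a′ i) → M S a ≡ M S a′
  M-cong S a≗a′ = ΣI-cong (λ I → cong (sign I *_) (∏-cong (λ i → cong (λ k → + (subSum S I i C k)) (a≗a′ i))))

  -- Vandermonde in every coordinate expresses a shifted sum through
  -- unshifted ones: alternating S g a = Σ_{b + c = a} Π_i C(g_i, b_i) · M S c.
  expansion : ∀ {r ℓ} (S : Seq r ℓ) (g a : Fin r → ℕ)
    → alternating S g a ≡ Conv a (λ b c → ∏ (λ i → + (g i C b i)) * M S c)
  expansion {r} {ℓ} S g a = begin
    ΣI (λ I → sign I * ∏ (λ i → + ((g i ℕ.+ σ I i) C a i)))
      ≡⟨ ΣI-cong {ℓ} (λ I → cong (sign I *_) (trans (∏-cong (λ i → vandermonde (g i) (σ I i) (a i)))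
                                                 (∏-conv a (λ i b → + (g i C b)) (λ i c → + (σ I i C c))))) ⟩
    ΣI (λ I → sign I * Conv a (λ b c → G b * Σ I c))
      ≡⟨ ΣI-cong {ℓ} (λ I → sym (Conv-*ˡ a (sign I) _)) ⟩
    ΣI (λ I → Conv a (λ b c → sign I * (G b * Σ I c)))
      ≡⟨ ΣI-Conv {ℓ} a _ ⟩
    Conv a (λ b c → ΣI (λ I → sign I * (G b * Σ I c)))
      ≡⟨ Conv-cong a (λ b c → trans (ΣI-cong {ℓ} (λ I → x∙yz≈y∙xz (sign I) (G b) (Σ I c)))
                                    (ΣI-*ˡ {ℓ} (G b) (λ I → sign I * Σ I c))) ⟩
    Conv a (λ b c → G b * M S c)
      ∎
    where
    open ≡-Reasoning
    σ = subSum S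
    G : (Fin r → ℕ) → ℤ
    G b = ∏ (λ i → + (g i C b i))
    Σ : (Fin ℓ → Bool) → (Fin r → ℕ) → ℤ
    Σ I c = ∏ (λ i → + (σ I i C c i))
    x∙yz≈y∙xz : ∀ x y z → x * (y * z) ≡ y * (x * z)
    x∙yz≈y∙xz = solve 3 (λ x y z → x :* (y :* z) := y :* (x :* z)) refl

  -- Splitting the subsets I of [ℓ + 1] by whether they contain the first
  -- index: M (g ∷ S′) a = M S′ a - alternating S′ g a.
  M-step : ∀ {r ℓ} (S : Seq r (suc ℓ)) a → M S a ≡ M (S ∘ suc) a - alternating (S ∘ suc) (S zero) a
  M-step {ℓ = ℓ} S a = cong (_+_ (M (S ∘ suc) a))
    (trans (ΣI-cong {ℓ} (λ I → sym (neg-distribˡ-* (sign I) _))) (ΣI-neg {ℓ} _))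

module PolynomialMethod {p : ℕ} (prime : Prime p) where

  open import Data.Nat
  open import Data.Nat.Properties
  open import Data.Nat.Divisibility using (_∣?_; 0∣⇒≡0; ∣1⇒≡1)
  open import Data.Nat.Combinatorics using (_C_; nCn≡1)
  open import Data.Nat.Primality using (prime⇒nonZero; prime⇒nonTrivial)
  open import Data.Integer as ℤ using (ℤ; +_; 1ℤ)
  open import Data.Integer.Properties as ℤ using ()
  open import Data.Integer.Divisibility.Signed using (∣ᵤ⇒∣; ∣⇒∣ᵤ; ∣n⇒∣m*n; ∣m⇒∣m*n)
    renaming (_∣_ to _∣ℤ_)
  open import Data.Fin using (Fin; zero; suc)
  open import Data.Fin.Properties using (any?)
  open import Data.Bool using (Bool; true; false)
  open import Data.Product using (∃; _,_)
  open import Data.Empty using (⊥-elim)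
  open import Relation.Nullary using (¬_; yes; no)
  open import Relation.Binary.PropositionalEquality
  open import Function using (_∘_)
  open NatSums
  open IntegerSums
  open AlternatingSums
  open PrimePower prime using (binomial-shift-∣)

  private instance
    p≢0 : NonZero p
    p≢0 = prime⇒nonZero prime

  p∤1 : ¬ + p ∣ℤ 1ℤ
  p∤1 p∣1 = nonTrivial⇒≢1 {{prime⇒nonTrivial prime}} (∣1⇒≡1 (∣⇒∣ᵤ p∣1))

  -- If every n_i divides p^e and S is zero-sumfree in ⊕_i C_{n_i}, then
  -- alternating S (n - 1) (n - 1) ≡ 1 modulo p: the term I = ∅ is 1, and for
  -- I ≠ ∅ some coordinate has n_i ∤ σ_I(S)_i, whence p ∣ C(n_i - 1 + σ_I(S)_i, n_i - 1).
  alternating≡1 : ∀ {r} e (n : Fin r → ℕ) → (∀ i → n i ∣ p ^ e) → ∀ {ℓ} (S : Seq r ℓ) → ZeroSumFree n S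
    → alternating S (λ i → n i ∸ 1) (λ i → n i ∸ 1) ≡ 1ℤ mod + p
  alternating≡1 e n n∣pᵉ {ℓ} S zsf = ΣI-mod 1ℤ term-∅ term-nonempty
    where
    m = λ i → n i ∸ 1
    suc-m : ∀ i → suc (m i) ≡ n i
    suc-m i with n i | n∣pᵉ i
    ... | zero  | 0∣pᵉ = ⊥-elim (<-irrefl (sym (0∣⇒≡0 0∣pᵉ)) (m^n>0 p e))
    ... | suc _ | _    = refl
    term : (Fin ℓ → Bool) → ℤ
    term I = sign I ℤ.* ∏ (λ i → + ((m i + subSum S I i) C m i))
    term-∅ : ∀ I → (∀ j → I j ≡ false) → term I ≡ 1ℤ
    term-∅ I I≗∅ = trans (cong₂ ℤ._*_ (sign-∅ I I≗∅) (∏-ones C[mᵢ,mᵢ]≡1)) (ℤ.*-identityˡ 1ℤ)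
      where
      C[mᵢ,mᵢ]≡1 : ∀ i → + ((m i + subSum S I i) C m i) ≡ 1ℤ
      C[mᵢ,mᵢ]≡1 i rewrite subSum-∅ S I I≗∅ i | +-identityʳ (m i) = cong +_ (nCn≡1 (m i))
    term-nonempty : ∀ I → (∃ λ j → I j ≡ true) → + p ∣ℤ term I
    term-nonempty I nonempty with any? (λ i → p ∣? ((m i + subSum S I i) C m i))
    ... | yes (i , p∣C) = ∣n⇒∣m*n (sign I) (∏-∣ (i , ∣ᵤ⇒∣ p∣C))
    ... | no  p∤any     = ⊥-elim (zsf I nonempty (λ i →
      subst (_∣ subSum S I i) (suc-m i)
            (binomial-shift-∣ e (subst (_∣ p ^ e) (sym (suc-m i)) (n∣pᵉ i)) (λ p∣C → p∤any (i , p∣C)))))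

  module Weighted {r : ℕ} (ω : Fin r → ℕ) (u : Elem r → ℕ) where

    Admissible : Elem r → Set
    Admissible g = ∀ i c → 0 < c → ¬ p ∣ (g i C c) → u g ≤ c * ω i

    weight : (Fin r → ℕ) → ℕ
    weight a = Σℕ (λ i → a i * ω i)

    total : ∀ {ℓ} → Seq r ℓ → ℕ
    total S = Σℕ (λ j → u (S j))

    weight-split : ∀ a b c → (∀ i → b i + c i ≡ a i) → weight a ≡ weight b + weight c
    weight-split a b c b+c≗a = trans
      (Σℕ-cong (λ i → trans (cong (_* ω i) (sym (b+c≗a i))) (*-distribʳ-+ (ω i) (b i) (c i))))
      (Σℕ-+ (λ i → b i * ω i) (λ i → c i * ω i))

    -- Induction on the length:
    -- by M-step and expansion, M (g ∷ S′) a ≡ -Σ_{b+c=a, b≠0} Π C(g_i, b_i)·M S′ c,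
    -- and each such term has a factor p ∣ C(g_i, b_i) or weight c < total S′.
    vanishing : ∀ ℓ (S : Seq r ℓ) → (∀ j → Admissible (S j)) → ∀ a → weight a < total S → + p ∣ℤ M S a
    vanishing zero    S adm a ()
    vanishing (suc ℓ) S adm a wa<tS =
      subst (+ p ∣ℤ_) (sym M-rewrite) (_≡_mod_.difference (mod-sym Conv≡M′))
      where
      S′ = S ∘ suc
      g  = S zero
      F : (Fin r → ℕ) → (Fin r → ℕ) → ℤ
      F b c = ∏ (λ i → + (g i C b i)) ℤ.* M S′ c
      M-rewrite : M S a ≡ M S′ a ℤ.- Conv a F
      M-rewrite = trans (M-step S a) (cong (ℤ._-_ (M S′ a)) (expansion S′ g a))
      F-at-0 : ∀ b c → (∀ i → b i ≡ 0) → (∀ i → c i ≡ a i) → F b c ≡ M S′ a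
      F-at-0 b c b≗0 c≗a = trans
        (cong₂ ℤ._*_ (∏-ones (λ i → cong (λ k → + (g i C k)) (b≗0 i))) (M-cong S′ c≗a))
        (ℤ.*-identityˡ _)
      F-elsewhere : ∀ b c → (∀ i → b i + c i ≡ a i) → (∃ λ i → 0 < b i) → + p ∣ℤ F b c
      F-elsewhere b c b+c≗a (i , 0<bᵢ) with p ∣? (g i C b i)
      ... | yes p∣C = ∣m⇒∣m*n (M S′ c) (∏-∣ (i , ∣ᵤ⇒∣ p∣C))
      ... | no  p∤C = ∣n⇒∣m*n (∏ (λ i → + (g i C b i)))
                              (vanishing ℓ S′ (adm ∘ suc) c (+-cancelˡ-< (u g) (weight c) (total S′) ug+wc<tS))
        where
        ug≤wb : u g ≤ weight b
        ug≤wb = ≤-trans (adm zero i (b i) 0<bᵢ p∤C) (term≤Σℕ (λ i → b i * ω i) i)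
        ug+wc<tS : u g + weight c < u g + total S′
        ug+wc<tS = ≤-<-trans
          (≤-trans (+-monoˡ-≤ (weight c) ug≤wb) (≤-reflexive (sym (weight-split a b c b+c≗a))))
          wa<tS
      Conv≡M′ : Conv a F ≡ M S′ a mod + p
      Conv≡M′ = Conv-mod a (M S′ a) F-at-0 F-elsewhere

    -- By expansion, the shifted sums vanish modulo p in the same range.
    alternating-∣ : ∀ {ℓ} (S : Seq r ℓ) → (∀ j → Admissible (S j)) → ∀ g a → weight a < total S
      → + p ∣ℤ alternating S g a
    alternating-∣ {ℓ} S adm g a wa<tS = subst (+ p ∣ℤ_) (sym (expansion S g a)) (Conv-∣ a (λ b c b+c≗a →
      ∣n⇒∣m*n (∏ (λ i → + (g i C b i))) (vanishing ℓ S adm c (≤-<-trans (weight-≤ b c b+c≗a) wa<tS))))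
      where
      weight-≤ : ∀ b c → (∀ i → b i + c i ≡ a i) → weight c ≤ weight a
      weight-≤ b c b+c≗a =
        Σℕ-mono (λ i → *-monoˡ-≤ (ω i) (≤-trans (m≤n+m (c i) (b i)) (≤-reflexive (b+c≗a i))))

    -- Olson-type bound: if every n_i divides p^e, a zero-sumfree sequence of
    -- admissible elements of ⊕_i C_{n_i} has total weight at most
    -- weight (n - 1); otherwise alternating S (n - 1) (n - 1) would be both
    -- divisible by p and ≡ 1 modulo p.
    total-bound : ∀ e (n : Fin r → ℕ) → (∀ i → n i ∣ p ^ e) → ∀ {ℓ} (S : Seq r ℓ)
      → ZeroSumFree n S → (∀ j → Admissible (S j)) → total S ≤ weight (λ i → n i ∸ 1)
    total-bound e n n∣pᵉ S zsf adm = ≮⇒≥ (λ w<t →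
      p∤1 (mod-∣ (alternating≡1 e n n∣pᵉ S zsf) (alternating-∣ S adm (λ i → n i ∸ 1) (λ i → n i ∸ 1) w<t)))

module Order {r : ℕ} (n : Fin r → ℕ) where

  open import Data.Nat
  open import Data.Nat.Properties
  open import Data.Nat.Divisibility
  open import Data.Nat.DivMod using (_%_; _/_; m≡m%n+[m/n]*n; m%n<n)
  open import Data.Fin.Properties using (all?)
  open import Data.Product using (_,_)
  open import Data.Sum using (_⊎_; inj₁; inj₂)
  open import Data.Bool using (true; false)
  open import Data.Empty using (⊥-elim)
  open import Relation.Nullary.Reflects using (Reflects; ofʸ; ofⁿ)
  open import Relation.Nullary.Decidable using (proof)
  open import Relation.Nullary using (¬_; yes; no)
  open import Relation.Binary.PropositionalEquality
  open NatSums using (Πℕ-pos; factor∣Πℕ)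

  Kills : Elem r → ℕ → Set
  Kills g k = IsZero n (k · g)

  record LeastKiller (g : Elem r) (k o : ℕ) : Set where
    field
      from   : k ≤ o
      kills  : Kills g o
      least  : ∀ m → k ≤ m → m < o → ¬ Kills g m

  isZero?-spec : ∀ h → (isZero? n h ≡ true × IsZero n h) ⊎ (isZero? n h ≡ false × ¬ IsZero n h)
  isZero?-spec h = from-reflects (proof (all? (λ c → n c ∣? h c)))
    where
    from-reflects : ∀ {P : Set} {b} → Reflects P b → (b ≡ true × P) ⊎ (b ≡ false × ¬ P)
    from-reflects (ofʸ p)  = inj₁ (refl , p)
    from-reflects (ofⁿ ¬p) = inj₂ (refl , ¬p)

  search : ∀ g fuel k → (∃ λ m → k ≤ m × m < k + fuel × Kills g m) → LeastKiller g k (ordSearch n g fuel k)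
  search g zero       k (m , k≤m , m<k+0 , _) =
    ⊥-elim (≤⇒≯ k≤m (subst (m <_) (+-identityʳ k) m<k+0))
  search g (suc fuel) k (m , k≤m , m<k+1+fuel , m-kills) with isZero?-spec (k · g)
  ... | inj₁ (eq , k-kills) rewrite eq =
    record { from = ≤-refl ; kills = k-kills ; least = λ m′ k≤m′ m′<k → ⊥-elim (≤⇒≯ k≤m′ m′<k) }
  ... | inj₂ (eq , k-fails) rewrite eq = record
    { from  = ≤-trans (n≤1+n k) (LeastKiller.from rest)
    ; kills = LeastKiller.kills rest
    ; least = least
    }
    where
    k≢m : k ≢ m
    k≢m refl = k-fails m-kills
    rest = search g fuel (suc k) (m , ≤∧≢⇒< k≤m k≢m , subst (m <_) (+-suc k fuel) m<k+1+fuel , m-kills)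
    least : ∀ m′ → k ≤ m′ → m′ < ordSearch n g fuel (suc k) → ¬ Kills g m′
    least m′ k≤m′ m′<o with k ≟ m′
    ... | yes refl = k-fails
    ... | no  k≢m′ = LeastKiller.least rest m′ (≤∧≢⇒< k≤m′ k≢m′) m′<o

  Π-kills : ∀ {g} → Kills g (Πℕ n)
  Π-kills {g} i = ∣m⇒∣m*n (g i) (factor∣Πℕ n i)

  module _ (n>0 : ∀ i → 0 < n i) (g : Elem r) where

    -- Πℕ n annihilates g, so the search finds the order.
    ord-spec : LeastKiller g 1 (ord n g)
    ord-spec = search g (Πℕ n) 1 (Πℕ n , Πℕ-pos n>0 , ≤-refl , Π-kills)

    ord-pos : 0 < ord n g
    ord-pos = LeastKiller.from ord-spec

    ord-kills : Kills g (ord n g)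
    ord-kills = LeastKiller.kills ord-spec

    ord-∣ : ∀ m → Kills g m → ord n g ∣ m
    ord-∣ m m-kills = m%n≡0⇒n∣m m o remainder≡0
      where
      o = ord n g
      instance
        o≢0 : NonZero o
        o≢0 = >-nonZero ord-pos
      remainder-kills : Kills g (m % o)
      remainder-kills i = ∣m+n∣m⇒∣n (subst (n i ∣_) split (m-kills i))
                                    (subst (n i ∣_) (sym (*-assoc (m / o) o (g i))) (∣n⇒∣m*n (m / o) (ord-kills i)))
        where
        split : m * g i ≡ m / o * o * g i + m % o * g i
        split = trans (cong (_* g i) (trans (m≡m%n+[m/n]*n m o) (+-comm (m % o) _)))
                      (*-distribʳ-+ (g i) (m / o * o) (m % o))
      remainder≡0 : m % o ≡ 0
      remainder≡0 with m % o | remainder-kills | m%n<n m o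
      ... | zero  | _     | _   = refl
      ... | suc k | kills | k<o = ⊥-elim (LeastKiller.least ord-spec (suc k) (s≤s z≤n) k<o kills)

    ord-∣Π : ord n g ∣ Πℕ n
    ord-∣Π = ord-∣ (Πℕ n) Π-kills

module CommonDenominator where

  open import Data.Nat as ℕ using (zero; suc; _+_; _*_)
  open import Data.Nat.Properties as ℕ using ()
  open import Data.Integer as ℤ using (+_; +≤+)
  open import Data.Integer.Properties as ℤ using ()
  open import Data.Integer.Solver using (module +-*-Solver)
  open +-*-Solver using (solve; _:+_; _:*_; _:=_)
  open import Data.Rational using (ℚ; toℚᵘ)
  open import Data.Rational.Properties using (toℚᵘ-fromℚᵘ; toℚᵘ-homo-+; toℚᵘ-cancel-≤)
  open import Data.Rational.Unnormalised using (mkℚᵘ; *≡*; *≤*)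
    renaming (_≃_ to _≃ᵘ_; _≤_ to _≤ᵘ_; _+_ to _+ᵘ_)
  open import Data.Rational.Unnormalised.Properties using (≃-trans; ≃-sym; +-cong; ≤-respˡ-≃; ≤-respʳ-≃)
  open import Data.Fin using (zero; suc)
  open import Relation.Binary.PropositionalEquality
  open import Function using (_∘_)
  open NatSums using (Σℕ-cong)

  frac≃ : ∀ a {d k N′} → k * d ≡ suc N′ → toℚᵘ (frac a d) ≃ᵘ mkℚᵘ (+ (a * k)) N′
  frac≃ a {zero}   {k} {N′} k*0≡N rewrite ℕ.*-zeroʳ k with () ← k*0≡N
  frac≃ a {suc d′} {k} {N′} k*d≡N = ≃-trans (toℚᵘ-fromℚᵘ (mkℚᵘ (+ a) d′)) (*≡* cross)
    where
    open ≡-Reasoning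
    cross : + a ℤ.* + suc N′ ≡ + (a * k) ℤ.* + suc d′
    cross = begin
      + a ℤ.* + suc N′          ≡⟨ ℤ.pos-* a (suc N′) ⟨
      + (a * suc N′)            ≡⟨ cong (λ z → + (a * z)) k*d≡N ⟨
      + (a * (k * suc d′))      ≡⟨ cong +_ (ℕ.*-assoc a k (suc d′)) ⟨
      + (a * k * suc d′)        ≡⟨ ℤ.pos-* (a * k) (suc d′) ⟩
      + (a * k) ℤ.* + suc d′    ∎

  +-common : ∀ x y N′ → mkℚᵘ (+ x) N′ +ᵘ mkℚᵘ (+ y) N′ ≃ᵘ mkℚᵘ (+ (x + y)) N′
  +-common x y N′ = *≡* (begin
    (+ x ℤ.* + N ℤ.+ + y ℤ.* + N) ℤ.* + N  ≡⟨ factor (+ x) (+ y) (+ N) ⟩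
    (+ x ℤ.+ + y) ℤ.* (+ N ℤ.* + N)         ≡⟨ cong₂ ℤ._*_ (ℤ.pos-+ x y) (ℤ.pos-* N N) ⟨
    + (x + y) ℤ.* + (N * N)                 ∎)
    where
    open ≡-Reasoning
    N = suc N′
    factor : ∀ x y N → (x ℤ.* N ℤ.+ y ℤ.* N) ℤ.* N ≡ (x ℤ.+ y) ℤ.* (N ℤ.* N)
    factor = solve 3 (λ x y N → (x :* N :+ y :* N) :* N := (x :+ y) :* (N :* N)) refl

  Σℚ≃ : ∀ {m} (f : Fin m → ℚ) (x : Fin m → ℕ) N′
    → (∀ i → toℚᵘ (f i) ≃ᵘ mkℚᵘ (+ x i) N′) → toℚᵘ (Σℚ f) ≃ᵘ mkℚᵘ (+ Σℕ x) N′
  Σℚ≃ {zero}  f x N′ f≃x = *≡* refl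
  Σℚ≃ {suc m} f x N′ f≃x = ≃-trans (toℚᵘ-homo-+ (f zero) (Σℚ (f ∘ suc))) (≃-trans
    (+-cong (f≃x zero) (Σℚ≃ (f ∘ suc) (x ∘ suc) N′ (f≃x ∘ suc)))
    (+-common (x zero) (Σℕ (x ∘ suc)) N′))

  Σℚ-≤ : ∀ {m m′} (f : Fin m → ℚ) (g : Fin m′ → ℚ) N′ (x : Fin m → ℕ) (y : Fin m′ → ℕ)
    → (∀ i → toℚᵘ (f i) ≃ᵘ mkℚᵘ (+ x i) N′) → (∀ j → toℚᵘ (g j) ≃ᵘ mkℚᵘ (+ y j) N′)
    → Σℕ x ≤ Σℕ y → Σℚ f ≤ℚ Σℚ g
  Σℚ-≤ f g N′ x y f≃x g≃y Σx≤Σy = toℚᵘ-cancel-≤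
    (≤-respˡ-≃ (≃-sym (Σℚ≃ f x N′ f≃x)) (≤-respʳ-≃ (≃-sym (Σℚ≃ g y N′ g≃y)) numerators-≤))
    where
    numerators-≤ : mkℚᵘ (+ Σℕ x) N′ ≤ᵘ mkℚᵘ (+ Σℕ y) N′
    numerators-≤ = *≤* (subst₂ ℤ._≤_ (ℤ.pos-* (Σℕ x) (suc N′)) (ℤ.pos-* (Σℕ y) (suc N′))
                                     (+≤+ (ℕ.*-monoˡ-≤ (suc N′) Σx≤Σy)))

  crossNumber-≤ : ∀ {r ℓ} (n : Fin r → ℕ) (S : Seq r ℓ) N′ (u : Fin ℓ → ℕ) (ω : Fin r → ℕ)
    → (∀ j → u j * ord n (S j) ≡ suc N′) → (∀ i → ω i * n i ≡ suc N′)
    → Σℕ u ≤ Σℕ (λ i → (n i ∸ 1) * ω i)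
    → crossNumber n S ≤ℚ Σℚ (λ i → frac (n i ∸ 1) (n i))
  crossNumber-≤ n S N′ u ω u-eq ω-eq Σu≤ =
    Σℚ-≤ _ _ N′ (λ j → 1 * u j) (λ i → (n i ∸ 1) * ω i)
         (λ j → frac≃ 1 (u-eq j)) (λ i → frac≃ (n i ∸ 1) (ω-eq i))
         (subst (_≤ _) (Σℕ-cong (λ j → sym (ℕ.*-identityˡ (u j)))) Σu≤)

-- With N = Πℕ n, weights ω_i = N / n_i and
-- u(g) = N / ord(g), every element is admissible, so the polynomial method
-- bounds Σ_j N / ord(S_j) by Σ_i (n_i - 1)·N / n_i for every zero-sumfree S.
module PGroupCase where

  open import Data.Nat
  open import Data.Nat.Properties
  open import Data.Nat.Divisibility
  open import Relation.Binary.PropositionalEquality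
  open import Data.Nat.Solver using (module +-*-Solver)
  open +-*-Solver using (solve; _:*_; _:=_)
  open NatSums using (Πℕ-pos; factor∣Πℕ)
  open CommonDenominator using (crossNumber-≤)

  p-group-bound : ∀ {r} (n : Fin r → ℕ) → (∀ i → 0 < n i) → ∀ {p} → Prime p → ∀ e → Πℕ n ≡ p ^ e
    → ∀ {ℓ} (S : Seq r ℓ) → ZeroSumFree n S → crossNumber n S ≤ℚ Σℚ (λ i → frac (n i ∸ 1) (n i))
  p-group-bound {r} n n>0 p-prime e Π≡pᵉ S zsf =
    crossNumber-≤ n S N′ (λ j → u (S j)) ω (λ j → u-eq (S j)) ω-eq
      (total-bound e n (λ i → subst (n i ∣_) Π≡pᵉ (factor∣Πℕ n i)) S zsf (λ j → admissible (S j)))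
    where
    open Order n using (ord-pos; ord-kills; ord-∣Π)
    N N′ : ℕ
    N  = Πℕ n
    N′ = N ∸ 1
    N≡1+N′ : N ≡ suc N′
    N≡1+N′ = sym (suc-pred N {{>-nonZero (Πℕ-pos n>0)}})
    ω : Fin r → ℕ
    ω i = quotient (factor∣Πℕ n i)
    ω-eq : ∀ i → ω i * n i ≡ suc N′
    ω-eq i = trans (sym (_∣_.equality (factor∣Πℕ n i))) N≡1+N′
    u : Elem r → ℕ
    u g = quotient (ord-∣Π n>0 g)
    u-eq : ∀ g → u g * ord n g ≡ suc N′
    u-eq g = trans (sym (_∣_.equality (ord-∣Π n>0 g))) N≡1+N′
    open PolynomialMethod.Weighted p-prime ω u using (Admissible; total-bound)
    open PrimePower p-prime using (binomial-absorb-∣)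
    -- p ∤ C(g_i, c) forces n_i ∣ ord(g)·c, hence N ∣ ω_i·c·ord(g) and u(g) ∣ c·ω_i.
    admissible : ∀ g → Admissible g
    admissible g i c 0<c p∤C = ∣⇒≤ {{cω≢0}} (*-cancelʳ-∣ o {{>-nonZero (ord-pos n>0 g)}} uo∣cωo)
      where
      o = ord n g
      nᵢ∣oc : n i ∣ o * c
      nᵢ∣oc = binomial-absorb-∣ e {q = o} (subst (n i ∣_) Π≡pᵉ (factor∣Πℕ n i)) p∤C 0<c (ord-kills n>0 g i)
      uo∣cωo : u g * o ∣ c * ω i * o
      uo∣cωo = subst₂ _∣_ (trans (ω-eq i) (sym (u-eq g))) (rearrange (ω i) o c) (*-monoʳ-∣ (ω i) nᵢ∣oc)
        where
        rearrange : ∀ w o c → w * (o * c) ≡ c * w * o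
        rearrange = solve 3 (λ w o c → w :* (o :* c) := c :* w :* o) refl
      cω≢0 : NonZero (c * ω i)
      cω≢0 = m*n≢0 c (ω i) {{>-nonZero 0<c}} {{ω≢0}}
        where
        ω≢0 : NonZero (ω i)
        ω≢0 = m*n≢0⇒m≢0 (ω i) {{subst NonZero (sym (ω-eq i)) _}}

-- Case (i): G = C_m is cyclic, m = n 0.  Classes modulo m of sums of properly
-- nested subsequences differ, so a zero-sumfree sequence has length ℓ < m
-- (Davenport's bound).  If ℓ = m - 1, comparing the subsequence {j} with the
-- prefixes of the ordering 0, j, … shows S_j ≡ S_0, hence all terms agree
-- modulo m, every multiple c·S_j with 0 < c < m is a prefix sum, and each
-- term has order m.
module CyclicCase (n : Fin 1 → ℕ) (n>0 : 0 < n Fin.zero) where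

  open import Data.Nat
  open import Data.Nat.Properties
  open import Data.Nat.Divisibility using (divides; ∣m+n∣m⇒∣n; n∣m*n; m∣m*n; m%n≡0⇒n∣m; n∣m⇒m%n≡0)
  open import Data.Nat.DivMod using (_%_; _/_; m≡m%n+[m/n]*n; m%n<n; %-distribˡ-+)
  open import Data.Fin as Fin using (zero; suc; fromℕ<)
  open import Data.Fin.Properties using (toℕ-fromℕ<; toℕ-injective; pigeonhole; toℕ<n)
  open import Data.Fin.Permutation using (Permutation; _⟨$⟩ʳ_; _⟨$⟩ˡ_; inverseˡ; inverseʳ; id; lift₀; transpose)
  open import Data.Bool using (Bool; true; false; if_then_else_; _∧_; not)
  open import Data.Bool.Properties using (T-≡)
  open import Data.Product using (_,_)
  open import Data.Empty using (⊥-elim)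
  open import Relation.Nullary using (¬_; yes; no; does)
  open import Relation.Nullary.Decidable using (dec-true; dec-false)
  open import Relation.Binary.PropositionalEquality
  open import Function using (_∘_; Equivalence)
  open NatSums using (Σℕ-cong; Σℕ-+; Σℕ-point; Σℕ-const)

  m : ℕ
  m = n zero

  instance
    m≢0 : NonZero m
    m≢0 = >-nonZero n>0

  _≈_ : ℕ → ℕ → Set
  x ≈ y = x % m ≡ y % m

  %-cancel : ∀ a d → (a + d) ≈ a → m ∣ d
  %-cancel a d a+d≈a = ∣m+n∣m⇒∣n (divides ((a + d) / m) (sym shifted)) (n∣m*n (a / m))
    where
    open ≡-Reasoning
    shifted : (a + d) / m * m ≡ a / m * m + d
    shifted = +-cancelˡ-≡ (a % m) _ _ (begin
      a % m + (a + d) / m * m    ≡⟨ cong (_+ (a + d) / m * m) a+d≈a ⟨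
      (a + d) % m + (a + d) / m * m ≡⟨ m≡m%n+[m/n]*n (a + d) m ⟨
      a + d                       ≡⟨ cong (_+ d) (m≡m%n+[m/n]*n a m) ⟩
      a % m + a / m * m + d       ≡⟨ +-assoc (a % m) _ d ⟩
      a % m + (a / m * m + d)     ∎)

  <ᵇ-true : ∀ {a b} → a < b → (a <ᵇ b) ≡ true
  <ᵇ-true a<b = Equivalence.to T-≡ (<⇒<ᵇ a<b)

  <ᵇ-sound : ∀ {a b} → (a <ᵇ b) ≡ true → a < b
  <ᵇ-sound {a} {b} a<ᵇb = <ᵇ⇒< a b (Equivalence.from T-≡ a<ᵇb)

  <ᵇ-false : ∀ {a b} → ¬ a < b → (a <ᵇ b) ≡ false
  <ᵇ-false {a} {b} a≮b with a <ᵇ b in a<ᵇb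
  ... | false = refl
  ... | true  = ⊥-elim (a≮b (<ᵇ-sound a<ᵇb))

  -- The position of x in the ordering π of the indices, and the set of the
  -- first t indices in that ordering.
  rank : ∀ {ℓ} → Permutation ℓ ℓ → Fin ℓ → ℕ
  rank π x = toℕ (π ⟨$⟩ˡ x)

  rank-at : ∀ {ℓ} (π : Permutation ℓ ℓ) i → rank π (π ⟨$⟩ʳ i) ≡ toℕ i
  rank-at π i = cong toℕ (inverseˡ π)

  rank-injective : ∀ {ℓ} (π : Permutation ℓ ℓ) {x y} → rank π x ≡ rank π y → x ≡ y
  rank-injective π same =
    trans (sym (inverseʳ π)) (trans (cong (π ⟨$⟩ʳ_) (toℕ-injective same)) (inverseʳ π))

  Prefix : ∀ {ℓ} → Permutation ℓ ℓ → ℕ → Fin ℓ → Bool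
  Prefix π t x = rank π x <ᵇ t

  module Subsequences {ℓ : ℕ} (S : Seq 1 ℓ) (zsf : ZeroSumFree n S) where

    σ : (Fin ℓ → Bool) → ℕ
    σ A = subSum S A zero

    σ-single : ∀ A x → A x ≡ true → (∀ y → y ≢ x → A y ≡ false) → σ A ≡ S x zero
    σ-single A x x∈A others∉A = trans
      (Σℕ-point _ x (λ y y≢x → cong (λ b → if b then S y zero else 0) (others∉A y y≢x)))
      (cong (λ b → if b then S x zero else 0) x∈A)

    -- Sums of properly nested subsets lie in different classes modulo m:
    -- their difference is the sum of a non-empty subsequence.
    nested-distinct : ∀ A B → (∀ x → A x ≡ true → B x ≡ true) → (∃ λ x → B x ≡ true × A x ≡ false)
      → ¬ σ A ≈ σ B
    nested-distinct A B A⊆B (x , x∈B , x∉A) σA≈σB =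
      zsf D (x , x∈D) (λ { zero → %-cancel (σ A) (σ D) (trans (cong (_% m) (sym split)) (sym σA≈σB)) })
      where
      D : Fin ℓ → Bool
      D y = B y ∧ not (A y)
      x∈D : D x ≡ true
      x∈D rewrite x∈B | x∉A = refl
      term : (Fin ℓ → Bool) → Fin ℓ → ℕ
      term X y = if X y then S y zero else 0
      term-split : ∀ y → term B y ≡ term A y + term D y
      term-split y with A y | B y | A⊆B y
      ... | true  | true  | _     = sym (+-identityʳ _)
      ... | true  | false | A⊆B′ with () ← A⊆B′ refl
      ... | false | true  | _     = refl
      ... | false | false | _     = refl
      split : σ B ≡ σ A + σ D
      split = trans (Σℕ-cong term-split) (Σℕ-+ (term A) (term D))

    collision : (A : Fin (suc m) → Fin ℓ → Bool) → ∃ λ a → ∃ λ b → a Fin.< b × σ (A a) ≈ σ (A b)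
    collision A with pigeonhole (n<1+n m) (λ a → fromℕ< (m%n<n (σ (A a)) m))
    ... | a , b , a<b , same = a , b , a<b , trans (sym (toℕ-fromℕ< _)) (trans (cong toℕ same) (toℕ-fromℕ< _))

    prefix-distinct : ∀ π {t₁ t₂} → t₁ < t₂ → t₁ < ℓ → ¬ σ (Prefix π t₁) ≈ σ (Prefix π t₂)
    prefix-distinct π {t₁} {t₂} t₁<t₂ t₁<ℓ = nested-distinct (Prefix π t₁) (Prefix π t₂)
      (λ y y∈P₁ → <ᵇ-true (<-trans (<ᵇ-sound y∈P₁) t₁<t₂))
      (x , <ᵇ-true (subst (_< t₂) (sym rank-x) t₁<t₂) , <ᵇ-false (<-irrefl rank-x))
      where
      x = π ⟨$⟩ʳ fromℕ< t₁<ℓ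
      rank-x : rank π x ≡ t₁
      rank-x = trans (rank-at π _) (toℕ-fromℕ< t₁<ℓ)

    -- Davenport's bound: the m + 1 prefixes of length 0, …, m would be
    -- properly nested if ℓ ≥ m.
    length<m : ℓ < m
    length<m with ℓ <? m
    ... | yes ℓ<m = ℓ<m
    ... | no  ℓ≮m with collision (λ a → Prefix id (toℕ a))
    ...   | a , b , a<b , same =
      ⊥-elim (prefix-distinct id a<b (<-≤-trans a<b (≤-trans (≤-pred (toℕ<n b)) (≮⇒≥ ℓ≮m))) same)

    -- If ℓ = m - 1, the first two terms of any ordering are congruent: among
    -- the m + 1 subsets {x₁}, P_0, …, P_{m-1} (P_t the first t terms) only
    -- {x₁} and P_1 = {x₀} are not properly nested.
    first-two : suc ℓ ≡ m → (π : Permutation ℓ ℓ) (x₀ x₁ : Fin ℓ) → rank π x₀ ≡ 0 → rank π x₁ ≡ 1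
      → S x₀ zero ≈ S x₁ zero
    first-two ℓ+1≡m π x₀ x₁ rank₀ rank₁ = classify (collision family)
      where
      E : Fin ℓ → Bool
      E y = does (y Fin.≟ x₁)
      family : Fin (suc m) → Fin ℓ → Bool
      family zero    = E
      family (suc t) = Prefix π (toℕ t)
      x₀≢x₁ : x₀ ≢ x₁
      x₀≢x₁ refl = 0≢1+n (trans (sym rank₀) rank₁)
      σE : σ E ≡ S x₁ zero
      σE = σ-single E x₁ (dec-true (x₁ Fin.≟ x₁) refl) (λ y y≢x₁ → dec-false (y Fin.≟ x₁) y≢x₁)
      σP₁ : σ (Prefix π 1) ≡ S x₀ zero
      σP₁ = σ-single (Prefix π 1) x₀ (<ᵇ-true (subst (_< 1) (sym rank₀) (s≤s z≤n)))
              (λ y y≢x₀ → <ᵇ-false (λ r<1 → y≢x₀ (rank-injective π (trans (n<1⇒n≡0 r<1) (sym rank₀)))))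
      classify : (∃ λ a → ∃ λ b → a Fin.< b × σ (family a) ≈ σ (family b)) → S x₀ zero ≈ S x₁ zero
      classify (zero , suc t , _ , same) with toℕ t
      ... | zero        =
        ⊥-elim (nested-distinct (Prefix π 0) E (λ _ ()) (x₁ , dec-true (x₁ Fin.≟ x₁) refl , refl) (sym same))
      ... | suc zero    = trans (cong (_% m) (sym σP₁)) (trans (sym same) (cong (_% m) σE))
      ... | suc (suc k) = ⊥-elim (nested-distinct E (Prefix π (2 + k)) E⊆P
              (x₀ , <ᵇ-true (subst (_< 2 + k) (sym rank₀) (s≤s z≤n)) , dec-false (x₀ Fin.≟ x₁) x₀≢x₁) same)
        where
        E⊆P : ∀ y → E y ≡ true → Prefix π (2 + k) y ≡ true
        E⊆P y y∈E with y Fin.≟ x₁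
        ... | yes refl = <ᵇ-true (subst (_< 2 + k) (sym rank₁) (s≤s (s≤s z≤n)))
      classify (suc t₁ , suc t₂ , t₁<t₂ , same) = ⊥-elim (prefix-distinct π (s≤s⁻¹ t₁<t₂) t₁<ℓ same)
        where
        t₁<ℓ : toℕ t₁ < ℓ
        t₁<ℓ = <-≤-trans (s≤s⁻¹ t₁<t₂) (≤-pred (subst (toℕ t₂ <_) (sym ℓ+1≡m) (toℕ<n t₂)))

  -- In a zero-sumfree sequence of length m - 1 every term is congruent to the
  -- first: compare the first two terms of the ordering 0, j, 1, 2, ….
  ≈-first : ∀ {k} (S : Seq 1 (suc k)) → ZeroSumFree n S → 2 + k ≡ m → ∀ j → S j zero ≈ S zero zero
  ≈-first         S zsf ℓ+1≡m zero    = refl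
  ≈-first {zero}  S zsf ℓ+1≡m (suc ())
  ≈-first {suc k} S zsf ℓ+1≡m (suc j) =
    sym (Subsequences.first-two S zsf ℓ+1≡m π zero (suc j) refl (rank-at π (suc zero)))
    where
    π : Permutation (2 + k) (2 + k)
    π = lift₀ (transpose zero j)

  Σℕ-%-cong : ∀ {ℓ} (f g : Fin ℓ → ℕ) → (∀ x → f x ≈ g x) → Σℕ f ≈ Σℕ g
  Σℕ-%-cong {zero}  f g f≈g = refl
  Σℕ-%-cong {suc ℓ} f g f≈g = begin
    (f zero + Σℕ (f ∘ suc)) % m               ≡⟨ %-distribˡ-+ (f zero) _ m ⟩
    (f zero % m + Σℕ (f ∘ suc) % m) % m
      ≡⟨ cong₂ (λ a b → (a + b) % m) (f≈g zero) (Σℕ-%-cong (f ∘ suc) (g ∘ suc) (f≈g ∘ suc)) ⟩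
    (g zero % m + Σℕ (g ∘ suc) % m) % m       ≡⟨ %-distribˡ-+ (g zero) _ m ⟨
    (g zero + Σℕ (g ∘ suc)) % m               ∎
    where open ≡-Reasoning

  Σℕ-prefix : ∀ {ℓ} c v → c ≤ ℓ → Σℕ {ℓ} (λ x → if toℕ x <ᵇ c then v else 0) ≡ c * v
  Σℕ-prefix {ℓ}     zero    v _         = trans (Σℕ-const {ℓ} 0) (*-zeroʳ ℓ)
  Σℕ-prefix {suc ℓ} (suc c) v (s≤s c≤ℓ) = cong (v +_) (Σℕ-prefix c v c≤ℓ)

  -- Consequently c·S_j ≡ S_0 + … + S_{c-1} modulo m, a non-empty subsequence
  -- sum, so c·S_j ≢ 0 for 0 < c < m.
  multiple-nonzero : ∀ {k} (S : Seq 1 (suc k)) → ZeroSumFree n S → 2 + k ≡ m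
    → ∀ j c → 0 < c → c < m → ¬ m ∣ c * S j zero
  multiple-nonzero {k} S zsf ℓ+1≡m j c 0<c c<m m∣cSⱼ =
    zsf (Prefix id c) (zero , <ᵇ-true 0<c) (λ { zero → m%n≡0⇒n∣m _ m prefix-sum≡0 })
    where
    open ≡-Reasoning
    term≈ : ∀ x → (if toℕ x <ᵇ c then S x zero else 0) ≈ (if toℕ x <ᵇ c then S j zero else 0)
    term≈ x with toℕ x <ᵇ c
    ... | true  = trans (≈-first S zsf ℓ+1≡m x) (sym (≈-first S zsf ℓ+1≡m j))
    ... | false = refl
    prefix-sum≡0 : subSum S (Prefix id c) zero % m ≡ 0
    prefix-sum≡0 = begin
      Σℕ {suc k} (λ x → if toℕ x <ᵇ c then S x zero else 0) % m
        ≡⟨ Σℕ-%-cong {suc k} _ _ term≈ ⟩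
      Σℕ {suc k} (λ x → if toℕ x <ᵇ c then S j zero else 0) % m
        ≡⟨ cong (_% m) (Σℕ-prefix {suc k} c (S j zero) c≤ℓ) ⟩
      c * S j zero % m
        ≡⟨ n∣m⇒m%n≡0 _ m m∣cSⱼ ⟩
      0 ∎
      where
      c≤ℓ : c ≤ suc k
      c≤ℓ = ≤-pred (subst (c <_) (sym ℓ+1≡m) c<m)

  ord≡m : ∀ {ℓ} (S : Seq 1 ℓ) → ZeroSumFree n S → suc ℓ ≡ m → ∀ j → ord n (S j) ≡ m
  ord≡m {suc k} S zsf ℓ+1≡m j = ≤-antisym ord≤m m≤ord
    where
    open Order n
    nᵢ>0 : ∀ i → 0 < n i
    nᵢ>0 zero = n>0
    ord≤m : ord n (S j) ≤ m
    ord≤m = ≮⇒≥ (λ m<ord →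
      LeastKiller.least (ord-spec nᵢ>0 (S j)) m n>0 m<ord (λ { zero → m∣m*n (S j zero) }))
    m≤ord : m ≤ ord n (S j)
    m≤ord = ≮⇒≥ (λ ord<m →
      multiple-nonzero S zsf ℓ+1≡m j _ (ord-pos nᵢ>0 (S j)) ord<m (ord-kills nᵢ>0 (S j) zero))

  -- Case (i) of the theorem: ℓ = m - 1 and every term contributes 1/m.
  cyclic-bound : ∀ {ℓ} (S : Seq 1 ℓ) → ZeroSumFree n S → Σℕ (λ i → n i ∸ 1) ≤ ℓ
    → crossNumber n S ≤ℚ Σℚ (λ i → frac (n i ∸ 1) (n i))
  cyclic-bound {ℓ} S zsf long = crossNumber-≤ n S ℓ (λ _ → 1) (λ _ → 1)
    (λ j → trans (*-identityˡ _) (trans (ord≡m S zsf ℓ+1≡m j) (sym ℓ+1≡m)))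
    (λ { zero → trans (*-identityˡ m) (sym ℓ+1≡m) })
    (≤-reflexive count)
    where
    open CommonDenominator using (crossNumber-≤)
    ℓ+1≡m : suc ℓ ≡ m
    ℓ+1≡m = ≤-antisym (Subsequences.length<m S zsf)
                      (subst (_≤ suc ℓ) (suc-pred m) (s≤s (subst (_≤ ℓ) (+-identityʳ (m ∸ 1)) long)))
    count : Σℕ {ℓ} (λ _ → 1) ≡ Σℕ (λ i → (n i ∸ 1) * 1)
    count = begin
      Σℕ {ℓ} (λ _ → 1)     ≡⟨ Σℕ-const {ℓ} 1 ⟩
      ℓ * 1                ≡⟨ cong (λ l → pred l * 1) ℓ+1≡m ⟩
      (m ∸ 1) * 1          ≡⟨ +-identityʳ _ ⟨
      (m ∸ 1) * 1 + 0      ∎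
      where open ≡-Reasoning

open import Data.Nat using (s≤s; z≤n)
open import Data.Nat.Properties using (<-trans)
open import Data.Fin using (zero)
open import Data.Sum using (inj₁; inj₂)
open import Data.Product using (_,_)
open import Relation.Binary.PropositionalEquality using (refl)

proposition2p3 : (r : ℕ) (n : Fin r → ℕ)
    → (∀ i → 1 < n i)
    → (∀ i j → toℕ i ≤ toℕ j → n i ∣ n j)
    → (r ≡ 1 ⊎ ∃ (λ p → Prime p × ∃ (λ e → Πℕ n ≡ p ^ e)))
    → (ℓ : ℕ) (S : Seq r ℓ)
    → ZeroSumFree n S
    → Σℕ (λ i → n i ∸ 1) ≤ ℓ
    → crossNumber n S ≤ℚ Σℚ (λ i → frac (n i ∸ 1) (n i))
proposition2p3 .1 n n>1 _ (inj₁ refl) ℓ S zsf long =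
  CyclicCase.cyclic-bound n (<-trans (s≤s z≤n) (n>1 zero)) S zsf long
proposition2p3 r n n>1 _ (inj₂ (p , p-prime , e , Π≡pᵉ)) ℓ S zsf _ =
  PGroupCase.p-group-bound n (λ i → <-trans (s≤s z≤n) (n>1 i)) p-prime e Π≡pᵉ S zsf
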